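{- Let $(G,\mathcal{H})$ be a non-piercing system with a tree-decomposition $(T,\mathcal{B})$ of $G$, $T$ rooted. Let $u$ be a node with parent $v$, $A_{uv}=B_u\cap B_v$, and let $H,H'\in\mathcal{H}$ both intersect $A_{uv}$. Then: (1) if $(H\cap G_u)\subsetneq(H'\cap G_u)$ and $H\cap A_{uv}=H'\cap A_{uv}$, then $(H'\cap G'_u)\subseteq(H\cap G'_u)$; (2) if $H\cap G_u$ and $H'\cap G_u$ properly intersect and $H\cap A_{uv}=H'\cap A_{uv}$, then $H\cap G'_u=H'\cap G'_u$; (3) if $H\cap G_u$ and $H'\cap G_u$ properly intersect and $(H\cap A_{uv})\subsetneq(H'\cap A_{uv})$, then $(H\cap G'_u)\subseteq(H'\cap G'_u)$.
   Context: $(G,\mathcal{H})$ is non-piercing if each $H\in\mathcal{H}$ is connected and for any $H,H'\in\mathcal{H}$, the subgraph of $H$ induced by the vertices of $H$ not in $H'$ is connected. $T_u$ is the subtree rooted at $u$; $G_u$ is the subgraph induced by the union of bags of $T_u$ and $G'_u$ the subgraph induced by the union of bags of $T\setminus T_u$. Intersections such as $H\cap G_u$, $H\cap A_{uv}$ are taken on vertex sets. Two sets $X,Y$ properly intersect if $X\setminus Y\neq\emptyset$ and $Y\setminus X\neq\emptyset$. -}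

module Defs where

open import Data.Nat using (ℕ)
open import Data.Fin using (Fin)
open import Data.Fin.Subset using (Subset; _∈_; _∉_)
open import Data.Maybe using (Maybe; just; nothing)
open import Data.Product using (Σ; ∃; _×_; _,_)
open import Data.Sum using (_⊎_)
open import Relation.Nullary using (¬_)
open import Relation.Binary.PropositionalEquality using (_≡_)

VSet : ℕ → Set₁
VSet n = Fin n → Set

_⊆ᵥ_ : ∀ {n} → VSet n → VSet n → Set
X ⊆ᵥ Y = ∀ x → X x → Y x

_≐ᵥ_ : ∀ {n} → VSet n → VSet n → Set
X ≐ᵥ Y = (X ⊆ᵥ Y) × (Y ⊆ᵥ X)

_⊊ᵥ_ : ∀ {n} → VSet n → VSet n → Set
X ⊊ᵥ Y = (X ⊆ᵥ Y) × ∃ λ y → Y y × ¬ X y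

ProperlyIntersect : ∀ {n} → VSet n → VSet n → Set
ProperlyIntersect X Y = (∃ λ x → X x × ¬ Y x) × (∃ λ y → Y y × ¬ X y)

_∩ᵥ_ : ∀ {n} → VSet n → VSet n → VSet n
(X ∩ᵥ Y) x = X x × Y x

record Graph (n : ℕ) : Set₁ where
  field
    Adj : Fin n → Fin n → Set
    sym : ∀ {x y} → Adj x y → Adj y x
open Graph public

data Walk {n} (Adj : Fin n → Fin n → Set) (S : VSet n) : Fin n → Fin n → Set where
  here : ∀ {x} → S x → Walk Adj S x x
  step : ∀ {x y z} → S x → Adj x y → Walk Adj S y z → Walk Adj S x z

-- the subgraph induced by S is connected (the empty set counts as connected)
Connected : ∀ {n} → (Fin n → Fin n → Set) → VSet n → Set
Connected Adj S = ∀ x y → S x → S y → Walk Adj S x y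

record NonPiercing {n k : ℕ} (G : Graph n) (ℋ : Fin k → Subset n) : Set where
  field
    conn    : ∀ i → Connected (Adj G) (_∈ ℋ i)
    nonpier : ∀ i j → Connected (Adj G) (λ x → x ∈ ℋ i × x ∉ ℋ j)

data Grounded {m} (par : Fin m → Maybe (Fin m)) : Fin m → Set where
  isRoot : ∀ {t} → par t ≡ nothing → Grounded par t
  up     : ∀ {t p} → par t ≡ just p → Grounded par p → Grounded par t

record RootedTree (m : ℕ) : Set where
  field
    par      : Fin m → Maybe (Fin m)
    root     : Fin m
    root-par : par root ≡ nothing
    root-uniq : ∀ t → par t ≡ nothing → t ≡ root
    grounded : ∀ t → Grounded par t
open RootedTree public

TAdj : ∀ {m} → RootedTree m → Fin m → Fin m → Set
TAdj T s t = (par T s ≡ just t) ⊎ (par T t ≡ just s)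

-- u ≼ w : w is a descendant of u (w ∈ T_u), including u itself
data Desc {m} (T : RootedTree m) (u : Fin m) : Fin m → Set where
  self  : Desc T u u
  child : ∀ {w p} → par T w ≡ just p → Desc T u p → Desc T u w

record TreeDecomposition {n m : ℕ} (G : Graph n) (T : RootedTree m) (B : Fin m → Subset n) : Set where
  field
    vertex-cover : ∀ x → ∃ λ t → x ∈ B t
    edge-cover   : ∀ x y → Adj G x y → ∃ λ t → x ∈ B t × y ∈ B t
    coherence    : ∀ x → Connected (TAdj T) (λ t → x ∈ B t)

Gᵤ : ∀ {n m} → RootedTree m → (Fin m → Subset n) → Fin m → VSet n
Gᵤ T B u x = ∃ λ t → Desc T u t × x ∈ B t

G'ᵤ : ∀ {n m} → RootedTree m → (Fin m → Subset n) → Fin m → VSet n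
G'ᵤ T B u x = ∃ λ t → ¬ Desc T u t × x ∈ B t

Aᵤᵥ : ∀ {n m} → (Fin m → Subset n) → Fin m → Fin m → VSet n
Aᵤᵥ B u v x = x ∈ B u × x ∈ B v

Vs : ∀ {n} → Subset n → VSet n
Vs H x = x ∈ H

module Submission where

open import Defs hiding (sym)
open import Data.Nat using (ℕ)
open import Data.Fin using (Fin; _≟_)
open import Data.Fin.Subset using (Subset; _∈_)
open import Data.Fin.Subset.Properties using (_∈?_)
open import Data.Maybe using (just)
open import Data.Maybe.Properties using (just-injective)
open import Data.Product using (∃; _×_; _,_; proj₁; proj₂)
open import Data.Sum using (inj₁; inj₂)
open import Function using (case_of_)
open import Relation.Nullary using (Dec; yes; no; ¬_; contradiction)
open import Relation.Binary.PropositionalEquality using (_≡_; refl; sym; trans; subst)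

-- A vertex of H ∖ H' in G_u and a vertex of H ∖ H' in G'_u are joined inside
-- H ∖ H' (non-piercing), and every such walk passes through the adhesion A_uv.
-- Hence if H ∩ A_uv ⊆ H' and H ∖ H' meets G_u, then H ∩ G'_u ⊆ H'.  All three
-- parts are instances of this, with the roles of H and H' chosen appropriately.

walk-source : ∀ {n} {Adj : Fin n → Fin n → Set} {S : VSet n} {x y} → Walk Adj S x y → S x
walk-source (here sx)     = sx
walk-source (step sx _ _) = sx

module _ {m : ℕ} (T : RootedTree m) (u : Fin m) where

  desc? : ∀ t → Dec (Desc T u t)
  desc? t = decide (grounded T t)
    where
    decide : ∀ {t} → Grounded (par T) t → Dec (Desc T u t)
    decide {t} g with u ≟ t
    ... | yes refl = yes self
    decide (isRoot eq) | no u≢t = no λ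
      { self         → u≢t refl
      ; (child pe _) → case trans (sym eq) pe of λ () }
    decide (up eq g) | no u≢t with decide g
    ... | yes d = yes (child eq d)
    ... | no ¬d = no λ
      { self         → u≢t refl
      ; (child pe d) → ¬d (subst (Desc T u) (just-injective (trans (sym pe) eq)) d) }

  edge-leaving-subtree : ∀ {v s t} → par T u ≡ just v →
                         TAdj T s t → Desc T u s → ¬ Desc T u t → s ≡ u × t ≡ v
  edge-leaving-subtree puv (inj₁ ps) self         _  = refl , just-injective (trans (sym ps) puv)
  edge-leaving-subtree puv (inj₁ ps) (child pe d) ¬d =
    contradiction (subst (Desc T u) (just-injective (trans (sym pe) ps)) d) ¬d
  edge-leaving-subtree puv (inj₂ pt) d            ¬d = contradiction (child pt d) ¬d

module _ {n m : ℕ} {G : Graph n} {T : RootedTree m} {B : Fin m → Subset n}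
         (TD : TreeDecomposition G T B) {u v : Fin m} (puv : par T u ≡ just v) where
  open TreeDecomposition TD

  Gᵤ∩G'ᵤ⊆Aᵤᵥ : ∀ x → Gᵤ T B u x → G'ᵤ T B u x → Aᵤᵥ B u v x
  Gᵤ∩G'ᵤ⊆Aᵤᵥ x (s , d , xs) (t , ¬d , xt) = leave (coherence x s t xs xt) d ¬d
    where
    leave : ∀ {s t} → Walk (TAdj T) (λ r → x ∈ B r) s t → Desc T u s → ¬ Desc T u t → Aᵤᵥ B u v x
    leave (here _) d ¬d = contradiction d ¬d
    leave (step {y = r} xs adj w) d ¬d with desc? T u r
    ... | yes dr = leave w dr ¬d
    ... | no ¬dr with edge-leaving-subtree T u puv adj d ¬dr
    ... | refl , refl = xs , walk-source w

  walk-meets-Aᵤᵥ : ∀ {S : VSet n} {y x} → Walk (Adj G) S y x →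
                   Gᵤ T B u y → G'ᵤ T B u x → ∃ λ z → S z × Aᵤᵥ B u v z
  walk-meets-Aᵤᵥ {x = x} (here sx) gy gx = x , sx , Gᵤ∩G'ᵤ⊆Aᵤᵥ x gy gx
  walk-meets-Aᵤᵥ {y = y} (step sy adj w) gy gx with edge-cover _ _ adj
  ... | t , yt , y't with desc? T u t
  ... | yes d = walk-meets-Aᵤᵥ w (t , d , y't) gx
  ... | no ¬d = y , sy , Gᵤ∩G'ᵤ⊆Aᵤᵥ y gy (t , ¬d , yt)

  module _ {k : ℕ} {ℋ : Fin k → Subset n} (NP : NonPiercing G ℋ) where
    open NonPiercing NP

    nonpiercing-transfer : ∀ i j →
      (∃ λ a → (Vs (ℋ i) ∩ᵥ Gᵤ T B u) a × ¬ (Vs (ℋ j) ∩ᵥ Gᵤ T B u) a) →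
      (Vs (ℋ i) ∩ᵥ Aᵤᵥ B u v) ⊆ᵥ (Vs (ℋ j) ∩ᵥ Aᵤᵥ B u v) →
      (Vs (ℋ i) ∩ᵥ G'ᵤ T B u) ⊆ᵥ (Vs (ℋ j) ∩ᵥ G'ᵤ T B u)
    nonpiercing-transfer i j (a , (ai , aG) , a∉j∩Gᵤ) Aᵢ⊆Aⱼ x (xi , xG') with x ∈? ℋ j
    ... | yes xj = xj , xG'
    ... | no x∉j with walk-meets-Aᵤᵥ (nonpier i j a x (ai , λ aj → a∉j∩Gᵤ (aj , aG)) (xi , x∉j)) aG xG'
    ... | z , (zi , z∉j) , zA = contradiction (proj₁ (Aᵢ⊆Aⱼ z (zi , zA))) z∉j

lemma12 : ∀ {n m k : ℕ} (G : Graph n) (ℋ : Fin k → Subset n) → NonPiercing G ℋ →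
    (T : RootedTree m) (B : Fin m → Subset n) → TreeDecomposition G T B →
    (u v : Fin m) → par T u ≡ just v →
    (i j : Fin k) →
    (∃ λ x → (Vs (ℋ i) ∩ᵥ Aᵤᵥ B u v) x) →
    (∃ λ x → (Vs (ℋ j) ∩ᵥ Aᵤᵥ B u v) x) →
    ((Vs (ℋ i) ∩ᵥ Gᵤ T B u) ⊊ᵥ (Vs (ℋ j) ∩ᵥ Gᵤ T B u) →
    (Vs (ℋ i) ∩ᵥ Aᵤᵥ B u v) ≐ᵥ (Vs (ℋ j) ∩ᵥ Aᵤᵥ B u v) →
    (Vs (ℋ j) ∩ᵥ G'ᵤ T B u) ⊆ᵥ (Vs (ℋ i) ∩ᵥ G'ᵤ T B u))
    × (ProperlyIntersect (Vs (ℋ i) ∩ᵥ Gᵤ T B u) (Vs (ℋ j) ∩ᵥ Gᵤ T B u) →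
    (Vs (ℋ i) ∩ᵥ Aᵤᵥ B u v) ≐ᵥ (Vs (ℋ j) ∩ᵥ Aᵤᵥ B u v) →
    (Vs (ℋ i) ∩ᵥ G'ᵤ T B u) ≐ᵥ (Vs (ℋ j) ∩ᵥ G'ᵤ T B u))
    × (ProperlyIntersect (Vs (ℋ i) ∩ᵥ Gᵤ T B u) (Vs (ℋ j) ∩ᵥ Gᵤ T B u) →
    (Vs (ℋ i) ∩ᵥ Aᵤᵥ B u v) ⊊ᵥ (Vs (ℋ j) ∩ᵥ Aᵤᵥ B u v) →
    (Vs (ℋ i) ∩ᵥ G'ᵤ T B u) ⊆ᵥ (Vs (ℋ j) ∩ᵥ G'ᵤ T B u))
lemma12 G ℋ NP T B TD u v puv i j _ _ =
    (λ (_ , outside) A-eq → nonpiercing-transfer TD puv NP j i outside (proj₂ A-eq))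
  , (λ (outsideᵢ , outsideⱼ) A-eq → nonpiercing-transfer TD puv NP i j outsideᵢ (proj₁ A-eq)
                                   , nonpiercing-transfer TD puv NP j i outsideⱼ (proj₂ A-eq))
  , (λ (outside , _) (A-sub , _) → nonpiercing-transfer TD puv NP i j outside A-sub)
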